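{- Let $\mathcal R$ be an LCTRS and $\Pi X.\,s\,[\exists\vec{x}.\varphi]$ an existentially constrained term. If $\Pi X.\,s\,[\exists\vec{x}.\varphi]$ is instantiation-normal with respect to $\mathcal R$, then $\Pi X.\,s\,[\exists\vec{x}.\varphi]$ is a normal form with respect to $\leadsto_{\mathcal R}$ (and hence also a normal form with respect to $\to_{\mathcal R}$).
   Context: Terms are built over a sorted signature whose function symbols are split into theory symbols (whose argument and result sorts are theory sorts) and term symbols, and a set $\mathcal{V}$ of sorted variables; theory sorts and symbols are interpreted in a fixed model $\mathcal{M}$. Every element of the interpretation of each theory sort is a constant symbol, called a value; $\mathcal{V}al$ denotes the set of values. There is a theory sort of Booleans with standard interpretation and the usual connectives. A constraint is a Boolean-sorted term built from theory symbols and variables; a (possibly existentially quantified) formula is valid if it is true under all valuations of its free variables in $\mathcal{M}$ and satisfiable if true under some. $\mathcal{V}ar(\cdot)$ is the set of variables. A substitution $\sigma$ is a sort-preserving map from variables to terms with finite domain $\mathcal{D}om(\sigma)=\{x\mid \sigma(x)\neq x\}$; $\mathcal{V}Dom(\sigma)=\{x\mid\sigma(x)\in\mathcal{V}al\}$; $\sigma$ is $X$-valued if $\sigma(X)\subseteq\mathcal{V}al$. An existential constraint $\exists\vec{x}.\varphi$ is a sequence of variables $\vec x$ together with a constraint $\varphi$ with $\{\vec x\}\subseteq\mathcal{V}ar(\varphi)$; its free variables are $\mathcal{FV}ar(\exists\vec x.\varphi)=\mathcal{V}ar(\varphi)\setminus\{\vec x\}$. For a substitution $\sigma$, $\sigma\vDash_{\mathcal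 M}\exists\vec x.\varphi$ means $\sigma$ is $\mathcal{FV}ar(\exists\vec x.\varphi)$-valued and $(\exists\vec x.\varphi)\sigma$ is valid. An existentially constrained term $\Pi X.\,s\,[\exists\vec x.\varphi]$ consists of a set $X$ of variables, a term $s$ and an existential constraint with $\mathcal{FV}ar(\exists\vec x.\varphi)\subseteq X\subseteq\mathcal{V}ar(s)$ and $\{\vec x\}\cap\mathcal{V}ar(s)=\emptyset$; it is satisfiable if $\exists\vec x.\varphi$ is satisfiable. A constrained rewrite rule $\rho\colon \Pi Z.\,\ell\to r\,[\pi]$ consists of a set $Z$ of variables, terms $\ell,r$ of the same sort and a constraint $\pi$ with $\mathcal{V}ar(\pi)\cup(\mathcal{V}ar(r)\setminus\mathcal{V}ar(\ell))\subseteq Z$; it is left-linear if $\ell$ is linear; $\mathcal{E}x\mathcal{V}ar(\rho)=\mathcal{V}ar(r)\setminus\mathcal{V}ar(\ell)$. Let $\Pi X.\,s\,[\exists\vec x.\varphi]$ be satisfiable, $\rho$ left-linear with $\mathcal{V}ar(\rho)\cap\mathcal{V}ar(s,\varphi)=\emptyset$, and $\{\vec z\}=\mathcal{V}ar(\pi)\setminus\mathcal{V}ar(\ell)$. The term has a $\rho$-redex at position $p$ of $s$ using $\gamma$ if (i) $\mathcal{D}om(\gamma)=\mathcal{V}ar(\ell)$, (ii) $s|_p=\ell\gamma$, (iii) $\gamma(x)\in\mathcal{V}al\cup X$ for all $x\in\mathcal{V}ar(\ell)\cap Z$, and (iv) $(\exists\vec x.\varphi)\Rightarrow(\exists\vec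 z.\pi\gamma)$ is valid; it has a partial $\rho$-redex at $p$ using $\gamma$ if (i)–(iii) hold and (iv') $(\exists\vec x.\varphi)\wedge(\exists\vec z.\pi\gamma)$ is satisfiable. In either case put $t=s[r\gamma]_p$, $\psi=\varphi\wedge\pi\gamma$, $\{\vec y\}=\mathcal{V}ar(\psi)\setminus\mathcal{V}ar(t)$, $Y=\mathcal{E}x\mathcal{V}ar(\rho)\cup(X\cap\mathcal{V}ar(t))$. A $\rho$-redex yields a most general rewrite step $\Pi X.\,s\,[\exists\vec x.\varphi]\to^p_{\rho,\gamma}\Pi Y.\,t\,[\exists\vec y.\psi]$, and a partial $\rho$-redex yields a partial rewrite step $\Pi X.\,s\,[\exists\vec x.\varphi]\leadsto^p_{\rho,\gamma}\Pi Y.\,t\,[\exists\vec y.\psi]$. One writes $\to_\rho$ (resp. $\leadsto_\rho$) if such a step exists for some position, some $\gamma$ and some renamed variant of $\rho$ whose variables are disjoint from those of the source term. An LCTRS $\mathcal R$ is a set of left-linear constrained rewrite rules (including the calculation rules for theory symbols); $\to_{\mathcal R}=\bigcup_{\rho\in\mathcal R}\to_\rho$ and $\leadsto_{\mathcal R}=\bigcup_{\rho\in\mathcal R}\leadsto_\rho$; a constrained term is a normal form w.r.t. one of these relations if it has no successor. For a set $R$ of pairs of ordinary terms, $u\to_R v$ means there are a position $p$, $\langle l,r'\rangle\in R$ and a substitution $\theta$ with $u|_p=l\theta$ and $v=u[r'\theta]_p$. Interpretation of a constrained term: $[\![\Pi X.\,s\,[\exists\vec x.\varphi]]\!]=\{s\sigma\mid\sigma(X)\subseteq\mathcal{V}al,\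 \sigma\vDash_{\mathcal M}\exists\vec x.\varphi\}$. Interpretation of a rule: $[\![\rho]\!]=\{\langle\ell\sigma,r\sigma\rangle\mid\mathcal{D}om(\sigma)=\mathcal{V}Dom(\sigma)=Z\cap\mathcal{V}ar(\ell,r),\ \sigma\vDash_{\mathcal M}\exists\vec z'.\pi\}$ where $\{\vec z'\}=\mathcal{V}ar(\pi)\setminus\mathcal{V}ar(\ell,r)$; $[\![\mathcal R]\!]=\bigcup_{\rho\in\mathcal R}[\![\rho]\!]$; rewriting of ordinary (unconstrained) terms by $\mathcal R$ is the relation $\to_{[\![\mathcal R]\!]}$. A constrained term $\Pi X.\,s\,[\exists\vec x.\varphi]$ is instantiation-normal with respect to $\mathcal R$ if every $u\in[\![\Pi X.\,s\,[\exists\vec x.\varphi]]\!]$ is a normal form with respect to $\to_{[\![\mathcal R]\!]}$. -}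

module Defs where

open import Data.Bool using (Bool; true; false; T; _∧_; not)
import Data.Bool.Properties as BoolP
open import Data.Nat using (ℕ; zero; suc)
open import Data.List using (List; []; _∷_; map)
open import Data.List.Relation.Unary.All using (All; []; _∷_)
open import Data.List.Membership.Propositional using (_∈_; _∉_)
open import Data.List.Relation.Unary.Unique.Propositional using (Unique)
open import Data.Product using (Σ; Σ-syntax; ∃; ∃-syntax; _×_; _,_; proj₁)
open import Data.Sum using (_⊎_)
open import Data.Unit using (⊤; tt)
open import Data.Empty using (⊥)
open import Relation.Nullary using (¬_; does)
open import Relation.Binary using (DecidableEquality)
open import Relation.Binary.PropositionalEquality using (_≡_; _≢_; refl; subst)
open import Relation.Unary using (Pred)
open import Function using (_⇔_)

data Sort (S : Set) : Set where
  boolS : Sort S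
  srt   : S → Sort S

record Setting : Set₁ where
  field
    S       : Set
    isThS   : S → Bool
    I       : S → Set                  -- interpretation of (theory) sorts
    eqDecI  : (s : S) → T (isThS s) → DecidableEquality (I s)
    F       : Set
    isThF   : F → Bool
    argsF   : F → List (Sort S)
    resF    : F → Sort S
    Var     : Sort S → Set
    _≟SV_   : DecidableEquality (Σ (Sort S) Var)
    -- every sort has infinitely many variables
    fresh   : (σ : Sort S) (L : List (Σ (Sort S) Var)) → Σ (Var σ) λ x → (σ , x) ∉ L

module Basics (𝒮 : Setting) where
  open Setting 𝒮 public

  IsTh : Sort S → Set
  IsTh boolS   = ⊤
  IsTh (srt s) = T (isThS s)

  Carrier : Sort S → Set
  Carrier boolS   = Bool
  Carrier (srt s) = I s

  _≟C_ : ∀ {σ} → IsTh σ → DecidableEquality (Carrier σ)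
  _≟C_ {boolS} _ = BoolP._≟_
  _≟C_ {srt s} th = eqDecI s th

record Model (𝒮 : Setting) : Set where
  open Basics 𝒮
  field
    thF-args : (f : F) → T (isThF f) → All IsTh (argsF f)
    thF-res  : (f : F) → T (isThF f) → IsTh (resF f)
    interpF  : (f : F) → T (isThF f) → All Carrier (argsF f) → Carrier (resF f)

module LCTRS {𝒮 : Setting} (𝓜 : Model 𝒮) where
  open Basics 𝒮 public
  open Model 𝓜 public

  SVar : Set
  SVar = Σ (Sort S) Var

  data Sym : Set where
    val  : (σ : Sort S) → IsTh σ → Carrier σ → Sym
    andS : Sym
    notS : Sym
    eqS  : (σ : Sort S) → IsTh σ → Sym
    fun  : F → Sym

  args : Sym → List (Sort S)
  args (val σ _ _) = []
  args andS        = boolS ∷ boolS ∷ []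
  args notS        = boolS ∷ []
  args (eqS σ _)   = σ ∷ σ ∷ []
  args (fun f)     = argsF f

  res : Sym → Sort S
  res (val σ _ _) = σ
  res andS        = boolS
  res notS        = boolS
  res (eqS _ _)   = boolS
  res (fun f)     = resF f

  IsThSym : Sym → Set
  IsThSym (fun f) = T (isThF f)
  IsThSym _       = ⊤

  IsValSym : Sym → Set
  IsValSym (val _ _ _) = ⊤
  IsValSym _           = ⊥

  resTh : (f : Sym) → IsThSym f → IsTh (res f)
  resTh (val σ th _) _ = th
  resTh andS _ = tt
  resTh notS _ = tt
  resTh (eqS _ _) _ = tt
  resTh (fun f) th = thF-res f th

  interpSym : (f : Sym) → IsThSym f → All Carrier (args f) → Carrier (res f)
  interpSym (val σ _ a) _ []               = a
  interpSym andS _ (a ∷ b ∷ [])            = a ∧ b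
  interpSym notS _ (a ∷ [])                = not a
  interpSym (eqS σ th) _ (a ∷ b ∷ [])      = does ((_≟C_ {σ} th) a b)
  interpSym (fun f) th vs                  = interpF f th vs

  data Term : Sort S → Set
  data Terms : List (Sort S) → Set

  data Term where
    var : ∀ {σ} → Var σ → Term σ
    app : ∀ {σ} (f : Sym) → res f ≡ σ → Terms (args f) → Term σ

  data Terms where
    []  : Terms []
    _∷_ : ∀ {σ σs} → Term σ → Terms σs → Terms (σ ∷ σs)

  data IsValue : ∀ {σ} → Term σ → Set where
    isVal : ∀ {σ} (th : IsTh σ) (a : Carrier σ) → IsValue (app (val σ th a) refl [])

  data _∈V_ : SVar → ∀ {σ} → Term σ → Set
  data _∈Vs_ : SVar → ∀ {σs} → Terms σs → Set
  data _∈V_ where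
    here : ∀ {σ} {x : Var σ} → (σ , x) ∈V var x
    arg  : ∀ {v σ f} {e : res f ≡ σ} {ts} → v ∈Vs ts → v ∈V app f e ts
  data _∈Vs_ where
    hd : ∀ {v σ σs} {t : Term σ} {ts : Terms σs} → v ∈V t → v ∈Vs (t ∷ ts)
    tl : ∀ {v σ σs} {t : Term σ} {ts : Terms σs} → v ∈Vs ts → v ∈Vs (t ∷ ts)

  Pos : Set
  Pos = List ℕ

  -- Sub s p u  :  s|_p = u
  data Sub : ∀ {σ τ} → Term σ → Pos → Term τ → Set
  data SubArgs : ∀ {σs τ} → Terms σs → ℕ → Pos → Term τ → Set
  data Sub where
    here  : ∀ {σ} {t : Term σ} → Sub t [] t
    there : ∀ {σ τ f i p} {e : res f ≡ σ} {ts} {u : Term τ} →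
            SubArgs ts i p u → Sub (app f e ts) (i ∷ p) u
  data SubArgs where
    zero : ∀ {σ σs τ p} {t : Term σ} {ts : Terms σs} {u : Term τ} →
           Sub t p u → SubArgs (t ∷ ts) zero p u
    suc  : ∀ {σ σs τ i p} {t : Term σ} {ts : Terms σs} {u : Term τ} →
           SubArgs ts i p u → SubArgs (t ∷ ts) (suc i) p u

  -- Repl s p u t  :  t = s[u]_p  (in particular p is a position of s and
  -- s|_p has the sort of u)
  data Repl : ∀ {σ τ} → Term σ → Pos → Term τ → Term σ → Set
  data ReplArgs : ∀ {σs τ} → Terms σs → ℕ → Pos → Term τ → Terms σs → Set
  data Repl where
    here  : ∀ {σ} {s u : Term σ} → Repl s [] u u
    there : ∀ {σ τ f i p} {e : res f ≡ σ} {ts ts'} {u : Term τ} →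
            ReplArgs ts i p u ts' → Repl (app f e ts) (i ∷ p) u (app f e ts')
  data ReplArgs where
    zero : ∀ {σ σs τ p} {t t' : Term σ} {ts : Terms σs} {u : Term τ} →
           Repl t p u t' → ReplArgs (t ∷ ts) zero p u (t' ∷ ts)
    suc  : ∀ {σ σs τ i p} {t : Term σ} {ts ts' : Terms σs} {u : Term τ} →
           ReplArgs ts i p u ts' → ReplArgs (t ∷ ts) (suc i) p u (t ∷ ts')

  Linear : ∀ {σ} → Term σ → Set
  Linear s = ∀ {τ} (x : Var τ) p q → Sub s p (var x) → Sub s q (var x) → p ≡ q

  data ThTerm : ∀ {σ} → Term σ → Set
  data ThTerms : ∀ {σs} → Terms σs → Set
  data ThTerm where
    var : ∀ {σ} (x : Var σ) → ThTerm (var x)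
    app : ∀ {σ f} {e : res f ≡ σ} {ts} → IsThSym f → ThTerms ts → ThTerm (app f e ts)
  data ThTerms where
    []  : ThTerms []
    _∷_ : ∀ {σ σs} {t : Term σ} {ts : Terms σs} → ThTerm t → ThTerms ts → ThTerms (t ∷ ts)

  IsConstraint : Term boolS → Set
  IsConstraint = ThTerm

  _∧C_ : Term boolS → Term boolS → Term boolS
  φ ∧C ψ = app andS refl (φ ∷ ψ ∷ [])

  Subst : Set
  Subst = ∀ {σ} → Var σ → Term σ

  _⟨_⟩  : ∀ {σ} → Term σ → Subst → Term σ
  _⟨_⟩s : ∀ {σs} → Terms σs → Subst → Terms σs
  var x ⟨ θ ⟩      = θ x
  app f e ts ⟨ θ ⟩ = app f e (ts ⟨ θ ⟩s)
  [] ⟨ θ ⟩s        = []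
  (t ∷ ts) ⟨ θ ⟩s  = (t ⟨ θ ⟩) ∷ (ts ⟨ θ ⟩s)

  FinDom : Subst → Set
  FinDom θ = Σ (List SVar) λ L → ∀ {σ} (x : Var σ) → θ x ≢ var x → (σ , x) ∈ L

  Valued : Pred SVar _ → Subst → Set
  Valued X θ = ∀ {σ} (x : Var σ) → X (σ , x) → IsValue (θ x)

  _∖_ : Subst → List SVar → Subst
  (θ ∖ xs) {σ} x with Data.List.Membership.DecPropositional._∈?_ _≟SV_ (σ , x) xs
    where import Data.List.Membership.DecPropositional
  ... | Relation.Nullary.yes _ = var x
  ... | Relation.Nullary.no _  = θ x

  Valuation : Set
  Valuation = ∀ {σ} → Var σ → IsTh σ → Carrier σ

  data Eval (ρ : Valuation) : ∀ {σ} → Term σ → Carrier σ → Set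
  data EvalArgs (ρ : Valuation) : ∀ {σs} → Terms σs → All Carrier σs → Set
  data Eval ρ where
    var : ∀ {σ} (x : Var σ) (th : IsTh σ) → Eval ρ (var x) (ρ x th)
    app : ∀ {σ f} (e : res f ≡ σ) {ts vs} (th : IsThSym f) →
          EvalArgs ρ ts vs → Eval ρ (app f e ts) (subst Carrier e (interpSym f th vs))
  data EvalArgs ρ where
    []  : EvalArgs ρ [] []
    _∷_ : ∀ {σ σs} {t : Term σ} {ts : Terms σs} {a vs} →
          Eval ρ t a → EvalArgs ρ ts vs → EvalArgs ρ (t ∷ ts) (a ∷ vs)

  record ECon : Set where
    constructor E[_]_
    field
      bound : List SVar
      body  : Term boolS
  open ECon public

  FVarE : ECon → Pred SVar _
  FVarE c v = v ∈V body c × v ∉ bound c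

  WfECon : ECon → Set
  WfECon c = IsConstraint (body c) × (∀ v → v ∈ bound c → v ∈V body c)

  _⊨E_ : Valuation → ECon → Set
  ρ ⊨E c = Σ Valuation λ ρ' →
             (∀ {σ} (x : Var σ) (th : IsTh σ) → (σ , x) ∉ bound c → ρ' x th ≡ ρ x th) ×
             Eval ρ' (body c) true

  Valid : ECon → Set
  Valid c = ∀ (ρ : Valuation) → ρ ⊨E c

  Satisfiable : ECon → Set
  Satisfiable c = Σ Valuation λ ρ → ρ ⊨E c

  _⟨_⟩E : ECon → Subst → ECon
  c ⟨ θ ⟩E = E[ bound c ] (body c ⟨ θ ∖ bound c ⟩)

  _⊨_ : Subst → ECon → Set
  θ ⊨ c = Valued (FVarE c) θ × Valid (c ⟨ θ ⟩E)

  record CTerm (τ : Sort S) : Set₁ where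
    field
      X   : Pred SVar Agda.Primitive.lzero
      s   : Term τ
      con : ECon
  open CTerm public

  WfCTerm : ∀ {τ} → CTerm τ → Set
  WfCTerm c = WfECon (con c) ×
              (∀ v → FVarE (con c) v → X c v) ×
              (∀ v → X c v → v ∈V s c) ×
              (∀ v → X c v → IsTh (proj₁ v)) ×
              (∀ v → v ∈ bound (con c) → ¬ (v ∈V s c))

  record Rule (τ : Sort S) : Set₁ where
    field
      Z     : Pred SVar Agda.Primitive.lzero
      lhs   : Term τ
      rhs   : Term τ
      guard : Term boolS
  open Rule public

  VarRule : ∀ {τ} → Rule τ → Pred SVar _
  VarRule ρ v = v ∈V lhs ρ ⊎ v ∈V rhs ρ ⊎ v ∈V guard ρ

  ExVar : ∀ {τ} → Rule τ → Pred SVar _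
  ExVar ρ v = v ∈V rhs ρ × ¬ (v ∈V lhs ρ)

  WfRule : ∀ {τ} → Rule τ → Set
  WfRule ρ = IsConstraint (guard ρ) ×
             (∀ v → v ∈V guard ρ → Z ρ v) ×
             (∀ v → ExVar ρ v → Z ρ v) ×
             (∀ v → Z ρ v → IsTh (proj₁ v))

  LeftLinear : ∀ {τ} → Rule τ → Set
  LeftLinear ρ = Linear (lhs ρ)

  Renaming : Set
  Renaming = ∀ {σ} → Var σ → Var σ

  IsBijection : Renaming → Set
  IsBijection θ = (∀ {σ} (x y : Var σ) → θ x ≡ θ y → x ≡ y) ×
                  (∀ {σ} (y : Var σ) → Σ (Var σ) λ x → θ x ≡ y)

  renameRule : ∀ {τ} → Renaming → Rule τ → Rule τ
  renameRule θ ρ = record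
    { Z     = λ { (σ , y) → Σ (Var σ) λ x → θ x ≡ y × Z ρ (σ , x) }
    ; lhs   = lhs ρ ⟨ (λ x → var (θ x)) ⟩
    ; rhs   = rhs ρ ⟨ (λ x → var (θ x)) ⟩
    ; guard = guard ρ ⟨ (λ x → var (θ x)) ⟩ }

  data Variant {τ} (ρ : Rule τ) : Rule τ → Set₁ where
    variant : (θ : Renaming) → IsBijection θ → Variant ρ (renameRule θ ρ)

  varTerms : ∀ {σs} → All Var σs → Terms σs
  varTerms []       = []
  varTerms (x ∷ xs) = var x ∷ varTerms xs

  varList : ∀ {σs} → All Var σs → List SVar
  varList {[]} []           = []
  varList {σ ∷ _} (x ∷ xs)  = (σ , x) ∷ varList xs

  record CalcRule (f : Sym) (th : IsThSym f) (ρ : Rule (res f)) : Set where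
    field
      xs       : All Var (args f)
      y        : Var (res f)
      distinct : Unique ((res f , y) ∷ varList xs)
      Z≡       : ∀ v → Z ρ v ⇔ v ∈ ((res f , y) ∷ varList xs)
      lhs≡     : lhs ρ ≡ app f refl (varTerms xs)
      rhs≡     : rhs ρ ≡ var y
      guard≡   : guard ρ ≡ app (eqS (res f) (resTh f th)) refl
                              (var y ∷ app f refl (varTerms xs) ∷ [])

  RuleSet : Set₂
  RuleSet = ∀ {τ} → Rule τ → Set₁

  IsLCTRS : RuleSet → Set₁
  IsLCTRS R = (∀ {τ} (ρ : Rule τ) → R ρ → WfRule ρ × LeftLinear ρ) ×
              (∀ (f : Sym) (th : IsThSym f) → ¬ IsValSym f →
                 Σ (Rule (res f)) λ ρ → R ρ × CalcRule f th ρ)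

  data Kind : Set where
    mostGeneral partial : Kind

  RedexCond : Kind → ECon → ECon → Set
  RedexCond mostGeneral A B = ∀ (ρ : Valuation) → ρ ⊨E A → ρ ⊨E B
  RedexCond partial     A B = Σ Valuation λ ρ → ρ ⊨E A × ρ ⊨E B

  -- Step k R c c' : c →_R c' (k = mostGeneral) or c ⇝_R c' (k = partial)
  data Step (k : Kind) (R : RuleSet) {τ} (c : CTerm τ) : CTerm τ → Set₂ where
    step :
      ∀ {σ} (ρ₀ ρ : Rule σ) → R ρ₀ → Variant ρ₀ ρ →
      Satisfiable (con c) →
      (∀ v → VarRule ρ v → ¬ (v ∈V s c ⊎ v ∈V body (con c))) →
      (p : Pos) (γ : Subst) →
      (zs : List SVar) → (∀ v → v ∈ zs ⇔ (v ∈V guard ρ × ¬ (v ∈V lhs ρ))) →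
      (∀ {σ'} (x : Var σ') → (γ x ≢ var x) ⇔ ((σ' , x) ∈V lhs ρ)) →
      Sub (s c) p (lhs ρ ⟨ γ ⟩) →
      (∀ {σ'} (x : Var σ') → (σ' , x) ∈V lhs ρ → Z ρ (σ' , x) →
         IsValue (γ x) ⊎ Σ (Var σ') (λ y → γ x ≡ var y × X c (σ' , y))) →
      RedexCond k (con c) (E[ zs ] (guard ρ ⟨ γ ⟩)) →
      (t : Term τ) → Repl (s c) p (rhs ρ ⟨ γ ⟩) t →
      (ys : List SVar) →
      (∀ v → v ∈ ys ⇔ (v ∈V (body (con c) ∧C (guard ρ ⟨ γ ⟩)) × ¬ (v ∈V t))) →
      Step k R c (record { X   = λ v → ExVar ρ v ⊎ (X c v × v ∈V t)
                         ; s   = t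
                         ; con = E[ ys ] (body (con c) ∧C (guard ρ ⟨ γ ⟩)) })

  NormalForm : Kind → RuleSet → ∀ {τ} → CTerm τ → Set₂
  NormalForm k R c = ∀ c' → ¬ Step k R c c'

  data InRule {τ} (ρ : Rule τ) : Term τ → Term τ → Set₁ where
    inst : (θ : Subst) → FinDom θ →
           (∀ {σ} (x : Var σ) → (θ x ≢ var x) ⇔ (Z ρ (σ , x) × ((σ , x) ∈V lhs ρ ⊎ (σ , x) ∈V rhs ρ))) →
           (∀ {σ} (x : Var σ) → IsValue (θ x) ⇔ (Z ρ (σ , x) × ((σ , x) ∈V lhs ρ ⊎ (σ , x) ∈V rhs ρ))) →
           (zs : List SVar) →
           (∀ v → v ∈ zs ⇔ (v ∈V guard ρ × ¬ (v ∈V lhs ρ ⊎ v ∈V rhs ρ))) →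
           θ ⊨ (E[ zs ] guard ρ) →
           InRule ρ (lhs ρ ⟨ θ ⟩) (rhs ρ ⟨ θ ⟩)

  data RStep (R : RuleSet) {τ} (u : Term τ) (v : Term τ) : Set₂ where
    rstep : ∀ {σ} (ρ : Rule σ) → R ρ → (l r : Term σ) → InRule ρ l r →
            (p : Pos) (θ : Subst) → FinDom θ →
            Sub u p (l ⟨ θ ⟩) → Repl u p (r ⟨ θ ⟩) v → RStep R u v

  TermNF : RuleSet → ∀ {τ} → Term τ → Set₂
  TermNF R u = ∀ v → ¬ RStep R u v

  InstNormal : RuleSet → ∀ {τ} → CTerm τ → Set₂
  InstNormal R c = ∀ (θ : Subst) → FinDom θ → Valued (X c) θ → θ ⊨ con c →
                   TermNF R (s c ⟨ θ ⟩)

-- A partial redex of Π X. s [∃x⃗.φ] with matcher γ yields an instance of s that is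
-- still reducible.  Take a valuation ν witnessing both ∃x⃗.φ and ∃z⃗.πγ, and let θ
-- send every theory variable of s to the value ν assigns to it: θ is X-valued and
-- satisfies ∃x⃗.φ.  The subterm sθ|_p = ℓγθ is then an instance of the original rule
-- under the rule substitution that maps the Z-variables of ℓ to their (value)
-- images under γθ and the extra variables of r to the values ν gives them, and
-- ν also witnesses the guard of that instance.  So sθ is not a normal form.  Most
-- general redexes are partial redexes, since the source is satisfiable.

module Submission where

open import Defs
open import Data.Bool using (true)
import Data.Bool.Properties as Bool
open import Data.List using (List; []; _∷_; _++_; filter)
open import Data.List.Relation.Unary.Any using (here; there)
open import Data.List.Membership.Propositional using (_∈_; _∉_)
open import Data.List.Membership.Propositional.Properties
  using (∈-++⁺ˡ; ∈-++⁺ʳ; ∈-++⁻; ∈-filter⁺; ∈-filter⁻)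
import Data.List.Membership.DecPropositional as DecMembership
open import Data.Product using (Σ; _×_; _,_; proj₁; proj₂)
open import Data.Sum using (_⊎_; inj₁; inj₂; [_,_])
open import Data.Unit using (tt)
open import Data.Empty using (⊥; ⊥-elim)
open import Relation.Nullary using (¬_; Dec; yes; no)
open import Relation.Nullary.Decidable using (map′; ¬?; _⊎-dec_; ¬¬-excluded-middle)
open import Relation.Binary.PropositionalEquality
  using (_≡_; _≢_; refl; sym; cong; cong₂; subst; module ≡-Reasoning)
open import Function using (_⇔_; mk⇔; Equivalence)

¬¬-decidable-on : ∀ {a} {A : Set a} (L : List A) (P : A → Set) →
                  ¬ ¬ (∀ v → v ∈ L → Dec (P v))
¬¬-decidable-on []      P k = k (λ _ ())
¬¬-decidable-on (w ∷ L) P k = ¬¬-decidable-on L P λ decL → ¬¬-excluded-middle λ decw →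
  k λ { v (here refl) → decw ; v (there v∈L) → decL v v∈L }

module TermFacts {𝒮 : Setting} (𝓜 : Model 𝒮) where
  open LCTRS 𝓜
  open DecMembership _≟SV_ using (_∈?_)

  vars  : ∀ {σ} → Term σ → List SVar
  varss : ∀ {σs} → Terms σs → List SVar
  vars (var {σ} x)  = (σ , x) ∷ []
  vars (app f e ts) = varss ts
  varss []          = []
  varss (t ∷ ts)    = vars t ++ varss ts

  ∈V⇒∈vars  : ∀ {v σ} {t : Term σ} → v ∈V t → v ∈ vars t
  ∈Vs⇒∈varss : ∀ {v σs} {ts : Terms σs} → v ∈Vs ts → v ∈ varss ts
  ∈V⇒∈vars here    = here refl
  ∈V⇒∈vars (arg m) = ∈Vs⇒∈varss m
  ∈Vs⇒∈varss (hd m)                = ∈-++⁺ˡ (∈V⇒∈vars m)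
  ∈Vs⇒∈varss {ts = t ∷ _} (tl m)  = ∈-++⁺ʳ (vars t) (∈Vs⇒∈varss m)

  ∈vars⇒∈V  : ∀ {v σ} (t : Term σ) → v ∈ vars t → v ∈V t
  ∈varss⇒∈Vs : ∀ {v σs} (ts : Terms σs) → v ∈ varss ts → v ∈Vs ts
  ∈vars⇒∈V (var x) (here refl) = here
  ∈vars⇒∈V (app f e ts) m      = arg (∈varss⇒∈Vs ts m)
  ∈varss⇒∈Vs (t ∷ ts) m with ∈-++⁻ (vars t) m
  ... | inj₁ m′ = hd (∈vars⇒∈V t m′)
  ... | inj₂ m′ = tl (∈varss⇒∈Vs ts m′)

  _∈V?_ : ∀ v {σ} (t : Term σ) → Dec (v ∈V t)
  v ∈V? t = map′ (∈vars⇒∈V t) ∈V⇒∈vars (v ∈? vars t)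

  IsTh? : ∀ σ → Dec (IsTh σ)
  IsTh? boolS   = yes tt
  IsTh? (srt s) = Bool.T? (isThS s)

  IsTh-irrelevant : ∀ {σ} (a b : IsTh σ) → a ≡ b
  IsTh-irrelevant {boolS} tt tt = refl
  IsTh-irrelevant {srt s} a b   = Bool.T-irrelevant a b

  _≟var_ : ∀ {σ} (t : Term σ) (y : Var σ) → Dec (t ≡ var y)
  _≟var_ {σ} (var z) y with (σ , z) ≟SV (σ , y)
  ... | yes refl = yes refl
  ... | no z≢y   = no λ { refl → z≢y refl }
  app f e ts ≟var y = no λ ()

  value : ∀ σ → IsTh σ → Carrier σ → Term σ
  value σ th a = app (val σ th a) refl []

  IsValue⇒≢var : ∀ {σ} {t : Term σ} {x : Var σ} → IsValue t → t ≢ var x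
  IsValue⇒≢var (isVal th a) ()

  ⟨⟩-∘  : ∀ {σ} (t : Term σ) (θ₁ θ₂ : Subst) →
          t ⟨ θ₁ ⟩ ⟨ θ₂ ⟩ ≡ t ⟨ (λ x → θ₁ x ⟨ θ₂ ⟩) ⟩
  ⟨⟩s-∘ : ∀ {σs} (ts : Terms σs) (θ₁ θ₂ : Subst) →
          ts ⟨ θ₁ ⟩s ⟨ θ₂ ⟩s ≡ ts ⟨ (λ x → θ₁ x ⟨ θ₂ ⟩) ⟩s
  ⟨⟩-∘ (var x) θ₁ θ₂       = refl
  ⟨⟩-∘ (app f e ts) θ₁ θ₂  = cong (app f e) (⟨⟩s-∘ ts θ₁ θ₂)
  ⟨⟩s-∘ [] θ₁ θ₂           = refl
  ⟨⟩s-∘ (t ∷ ts) θ₁ θ₂     = cong₂ _∷_ (⟨⟩-∘ t θ₁ θ₂) (⟨⟩s-∘ ts θ₁ θ₂)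

  ⟨⟩-cong  : ∀ {σ} (t : Term σ) {θ₁ θ₂ : Subst} →
             (∀ {σ′} (x : Var σ′) → (σ′ , x) ∈V t → θ₁ x ≡ θ₂ x) → t ⟨ θ₁ ⟩ ≡ t ⟨ θ₂ ⟩
  ⟨⟩s-cong : ∀ {σs} (ts : Terms σs) {θ₁ θ₂ : Subst} →
             (∀ {σ′} (x : Var σ′) → (σ′ , x) ∈Vs ts → θ₁ x ≡ θ₂ x) → ts ⟨ θ₁ ⟩s ≡ ts ⟨ θ₂ ⟩s
  ⟨⟩-cong (var x) eq       = eq x here
  ⟨⟩-cong (app f e ts) eq  = cong (app f e) (⟨⟩s-cong ts λ x m → eq x (arg m))
  ⟨⟩s-cong [] eq           = refl
  ⟨⟩s-cong (t ∷ ts) eq     = cong₂ _∷_ (⟨⟩-cong t λ x m → eq x (hd m)) (⟨⟩s-cong ts λ x m → eq x (tl m))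

  ⟨⟩-identity  : ∀ {σ} (t : Term σ) → t ⟨ var ⟩ ≡ t
  ⟨⟩s-identity : ∀ {σs} (ts : Terms σs) → ts ⟨ var ⟩s ≡ ts
  ⟨⟩-identity (var x)      = refl
  ⟨⟩-identity (app f e ts) = cong (app f e) (⟨⟩s-identity ts)
  ⟨⟩s-identity []          = refl
  ⟨⟩s-identity (t ∷ ts)    = cong₂ _∷_ (⟨⟩-identity t) (⟨⟩s-identity ts)

  IsValue-⟨⟩ : ∀ {σ} {w : Term σ} (θ : Subst) → IsValue w → w ⟨ θ ⟩ ≡ w
  IsValue-⟨⟩ θ (isVal th a) = refl

  Sub-⟨⟩     : ∀ {σ τ} {s : Term σ} {p} {u : Term τ} (θ : Subst) →
               Sub s p u → Sub (s ⟨ θ ⟩) p (u ⟨ θ ⟩)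
  SubArgs-⟨⟩ : ∀ {σs τ} {ts : Terms σs} {i p} {u : Term τ} (θ : Subst) →
               SubArgs ts i p u → SubArgs (ts ⟨ θ ⟩s) i p (u ⟨ θ ⟩)
  Sub-⟨⟩ θ here          = here
  Sub-⟨⟩ θ (there m)     = there (SubArgs-⟨⟩ θ m)
  SubArgs-⟨⟩ θ (zero m)  = zero (Sub-⟨⟩ θ m)
  SubArgs-⟨⟩ θ (suc m)   = suc (SubArgs-⟨⟩ θ m)

  Sub⇒Repl     : ∀ {σ τ} {s : Term σ} {p} {u : Term τ} → Sub s p u →
                 (w : Term τ) → Σ (Term σ) λ t → Repl s p w t
  SubArgs⇒Repl : ∀ {σs τ} {ts : Terms σs} {i p} {u : Term τ} → SubArgs ts i p u →
                 (w : Term τ) → Σ (Terms σs) λ ts′ → ReplArgs ts i p w ts′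
  Sub⇒Repl here w = w , here
  Sub⇒Repl (there m) w with SubArgs⇒Repl m w
  ... | _ , r = _ , there r
  SubArgs⇒Repl (zero m) w with Sub⇒Repl m w
  ... | _ , r = _ , zero r
  SubArgs⇒Repl (suc m) w with SubArgs⇒Repl m w
  ... | _ , r = _ , suc r

  ∈V-rename  : ∀ {σ σ′} (ren : Renaming) (t : Term σ) {x : Var σ′} →
               (σ′ , x) ∈V t → (σ′ , ren x) ∈V (t ⟨ (λ y → var (ren y)) ⟩)
  ∈Vs-rename : ∀ {σs σ′} (ren : Renaming) (ts : Terms σs) {x : Var σ′} →
               (σ′ , x) ∈Vs ts → (σ′ , ren x) ∈Vs (ts ⟨ (λ y → var (ren y)) ⟩s)
  ∈V-rename ren (var x) here             = here
  ∈V-rename ren (app f e ts) (arg m)     = arg (∈Vs-rename ren ts m)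
  ∈Vs-rename ren (t ∷ ts) (hd m)         = hd (∈V-rename ren t m)
  ∈Vs-rename ren (t ∷ ts) (tl m)         = tl (∈Vs-rename ren ts m)

  ∈V-rename⁻  : ∀ {σ σ′} (ren : Renaming) (t : Term σ) {y : Var σ′} →
                (σ′ , y) ∈V (t ⟨ (λ z → var (ren z)) ⟩) →
                Σ (Var σ′) λ x → ren x ≡ y × (σ′ , x) ∈V t
  ∈Vs-rename⁻ : ∀ {σs σ′} (ren : Renaming) (ts : Terms σs) {y : Var σ′} →
                (σ′ , y) ∈Vs (ts ⟨ (λ z → var (ren z)) ⟩s) →
                Σ (Var σ′) λ x → ren x ≡ y × (σ′ , x) ∈Vs ts
  ∈V-rename⁻ ren (var x) here = x , refl , here
  ∈V-rename⁻ ren (app f e ts) (arg m) with ∈Vs-rename⁻ ren ts m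
  ... | x , eq , m′ = x , eq , arg m′
  ∈Vs-rename⁻ ren (t ∷ ts) (hd m) with ∈V-rename⁻ ren t m
  ... | x , eq , m′ = x , eq , hd m′
  ∈Vs-rename⁻ ren (t ∷ ts) (tl m) with ∈Vs-rename⁻ ren ts m
  ... | x , eq , m′ = x , eq , tl m′

  _↾_ : Subst → List SVar → Subst
  (θ ↾ L) {σ} x with (σ , x) ∈? L
  ... | yes _ = θ x
  ... | no _  = var x

  ↾-∈ : ∀ (θ : Subst) L {σ} (x : Var σ) → (σ , x) ∈ L → (θ ↾ L) x ≡ θ x
  ↾-∈ θ L {σ} x x∈L with (σ , x) ∈? L
  ... | yes _   = refl
  ... | no x∉L  = ⊥-elim (x∉L x∈L)

  ↾-FinDom : ∀ (θ : Subst) L → FinDom (θ ↾ L)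
  ↾-FinDom θ L = L , dom
    where
    dom : ∀ {σ} (x : Var σ) → (θ ↾ L) x ≢ var x → (σ , x) ∈ L
    dom {σ} x moved with (σ , x) ∈? L
    ... | yes x∈L = x∈L
    ... | no _    = ⊥-elim (moved refl)

  ⌜_⌝ : Valuation → Subst
  ⌜ ν ⌝ {σ} x with IsTh? σ
  ... | yes th = value σ th (ν x th)
  ... | no _   = var x

  ⌜⌝-value : ∀ (ν : Valuation) {σ} (x : Var σ) (th : IsTh σ) → ⌜ ν ⌝ x ≡ value σ th (ν x th)
  ⌜⌝-value ν {σ} x th with IsTh? σ
  ... | yes th′ = cong (λ h → value σ h (ν x h)) (IsTh-irrelevant {σ} th′ th)
  ... | no ¬th  = ⊥-elim (¬th th)

  ⌜⌝-IsValue : ∀ (ν : Valuation) {σ} (x : Var σ) → IsTh σ → IsValue (⌜ ν ⌝ x)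
  ⌜⌝-IsValue ν x th rewrite ⌜⌝-value ν x th = isVal _ _

  Eval-IsValue : ∀ {σ} {w : Term σ} {ν μ : Valuation} {b} → IsValue w → Eval ν w b → Eval μ w b
  Eval-IsValue (isVal th a) (app refl tt []) = app refl tt []

  Eval-⌜⌝ : ∀ {ν : Valuation} {σ} {x : Var σ} {b} → Eval ν (var x) b → ∀ (μ : Valuation) → Eval μ (⌜ ν ⌝ x) b
  Eval-⌜⌝ {ν} (var x th) μ rewrite ⌜⌝-value ν x th = app refl tt []

  Eval-⟨⟩  : ∀ {σ} (t : Term σ) {θ₁ θ₂ : Subst} {ν₁ ν₂ : Valuation} →
             (∀ {σ′} (x : Var σ′) → (σ′ , x) ∈V t → ∀ {b} → Eval ν₁ (θ₁ x) b → Eval ν₂ (θ₂ x) b) →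
             ∀ {a} → Eval ν₁ (t ⟨ θ₁ ⟩) a → Eval ν₂ (t ⟨ θ₂ ⟩) a
  Evals-⟨⟩ : ∀ {σs} (ts : Terms σs) {θ₁ θ₂ : Subst} {ν₁ ν₂ : Valuation} →
             (∀ {σ′} (x : Var σ′) → (σ′ , x) ∈Vs ts → ∀ {b} → Eval ν₁ (θ₁ x) b → Eval ν₂ (θ₂ x) b) →
             ∀ {as} → EvalArgs ν₁ (ts ⟨ θ₁ ⟩s) as → EvalArgs ν₂ (ts ⟨ θ₂ ⟩s) as
  Eval-⟨⟩ (var x) h ev                       = h x here ev
  Eval-⟨⟩ (app f e ts) h (app .e th evs)      = app e th (Evals-⟨⟩ ts (λ x m → h x (arg m)) evs)
  Evals-⟨⟩ [] h []                           = []
  Evals-⟨⟩ (t ∷ ts) h (ev ∷ evs)             =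
    Eval-⟨⟩ t (λ x m → h x (hd m)) ev ∷ Evals-⟨⟩ ts (λ x m → h x (tl m)) evs

  override : List SVar → Valuation → Valuation → Valuation
  override L κ μ {σ} x th with (σ , x) ∈? L
  ... | yes _ = κ x th
  ... | no _  = μ x th

  override-∈ : ∀ L (κ μ : Valuation) {σ} {x : Var σ} {b} → (σ , x) ∈ L →
               Eval κ (var x) b → Eval (override L κ μ) (var x) b
  override-∈ L κ μ {σ} {x} x∈L (var x th) with (σ , x) ∈? L | var {ρ = override L κ μ} x th
  ... | yes _  | ev = ev
  ... | no x∉L | _  = ⊥-elim (x∉L x∈L)

  override-∉ : ∀ L (κ μ : Valuation) {σ} (x : Var σ) (th : IsTh σ) → (σ , x) ∉ L → override L κ μ x th ≡ μ x th
  override-∉ L κ μ {σ} x th x∉L with (σ , x) ∈? L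
  ... | yes x∈L = ⊥-elim (x∉L x∈L)
  ... | no _    = refl

  -- A single true instance φτ makes (∃x⃗.φ)θ valid: under any μ, interpret the bound
  -- variables by κ and the free ones through the closed terms θ x.
  Valid-⟨⟩E : ∀ (c : ECon) (θ τ : Subst) (ν κ : Valuation) →
              Eval ν (body c ⟨ τ ⟩) true →
              (∀ {σ} (x : Var σ) → (σ , x) ∈ bound c → ∀ {b} → Eval ν (τ x) b → Eval κ (var x) b) →
              (∀ {σ} (x : Var σ) → FVarE c (σ , x) → ∀ {b} → Eval ν (τ x) b → ∀ (μ : Valuation) → Eval μ (θ x) b) →
              Valid (c ⟨ θ ⟩E)
  Valid-⟨⟩E (E[ xs ] φ) θ τ ν κ φτ-true bound-ok free-ok μ =
    override xs κ μ , (λ x th x∉xs → override-∉ xs κ μ x th x∉xs) , Eval-⟨⟩ φ agree φτ-true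
    where
    agree : ∀ {σ} (x : Var σ) → (σ , x) ∈V φ → ∀ {b} → Eval ν (τ x) b →
            Eval (override xs κ μ) ((θ ∖ xs) x) b
    agree {σ} x x∈φ ev with (σ , x) ∈? xs
    ... | yes x∈xs = override-∈ xs κ μ x∈xs (bound-ok x x∈xs ev)
    ... | no x∉xs  = free-ok x (x∈φ , x∉xs) ev (override xs κ μ)

  ⊨E⇒⊨ : ∀ (c : ECon) (θ : Subst) (ν : Valuation) → ν ⊨E c →
         (∀ {σ} (x : Var σ) → FVarE c (σ , x) → IsTh σ × θ x ≡ ⌜ ν ⌝ x) →
         θ ⊨ c
  ⊨E⇒⊨ c θ ν (ν′ , ν′≈ν , c-true) θ-free =
    valued , Valid-⟨⟩E c θ var ν′ ν′ c-var-true (λ _ _ ev → ev) free-ok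
    where
    valued : Valued (FVarE c) θ
    valued x free with θ-free x free
    ... | th , eq rewrite eq = ⌜⌝-IsValue ν x th

    c-var-true : Eval ν′ (body c ⟨ var ⟩) true
    c-var-true rewrite ⟨⟩-identity (body c) = c-true

    free-ok : ∀ {σ} (x : Var σ) → FVarE c (σ , x) → ∀ {b} → Eval ν′ (var x) b →
              ∀ (μ : Valuation) → Eval μ (θ x) b
    free-ok x free (var x th) μ rewrite proj₂ (θ-free x free) | ν′≈ν x th (proj₂ free) =
      Eval-⌜⌝ (var x th) μ

module _ {𝒮 : Setting} (𝓜 : Model 𝒮) where
  open LCTRS 𝓜
  open TermFacts 𝓜
  open Equivalence

  module PartialRedexInstance
    (R : RuleSet) {τ : Sort S} (c : CTerm τ) (wf : WfCTerm c)
    {σ : Sort S} (ρ₀ : Rule σ) (Rρ₀ : R ρ₀) (wfρ₀ : WfRule ρ₀)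
    (decZ : ∀ v → v ∈V lhs ρ₀ → Dec (Z ρ₀ v))
    (ren : Renaming) (ren-injective : ∀ {σ′} (x y : Var σ′) → ren x ≡ ren y → x ≡ y)
    (p : Pos) (γ : Subst) (zs : List SVar)
    (s-vars∉zs : ∀ v → v ∈V s c → v ∉ zs)
    (γ-dom : ∀ {σ′} (x : Var σ′) → (γ x ≢ var x) ⇔ ((σ′ , x) ∈V lhs (renameRule ren ρ₀)))
    (s|p≡ℓγ : Sub (s c) p (lhs (renameRule ren ρ₀) ⟨ γ ⟩))
    (γ-Z : ∀ {σ′} (x : Var σ′) → (σ′ , x) ∈V lhs (renameRule ren ρ₀) → Z (renameRule ren ρ₀) (σ′ , x) →
           IsValue (γ x) ⊎ Σ (Var σ′) (λ y → γ x ≡ var y × X c (σ′ , y)))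
    (ν : Valuation) (ν⊨φ : ν ⊨E con c)
    (ν₂ : Valuation) (ν₂≈ν : ∀ {σ′} (x : Var σ′) (th : IsTh σ′) → (σ′ , x) ∉ zs → ν₂ x th ≡ ν x th)
    (πγ-true : Eval ν₂ (guard (renameRule ren ρ₀) ⟨ γ ⟩) true)
    where

    ℓ₀ r₀ : Term σ
    ℓ₀ = lhs ρ₀
    r₀ = rhs ρ₀

    π₀ : Term boolS
    π₀ = guard ρ₀

    π₀⊆Z : ∀ v → v ∈V π₀ → Z ρ₀ v
    π₀⊆Z = proj₁ (proj₂ wfρ₀)

    ExVar⊆Z : ∀ v → ExVar ρ₀ v → Z ρ₀ v
    ExVar⊆Z = proj₁ (proj₂ (proj₂ wfρ₀))

    Z⇒IsTh : ∀ v → Z ρ₀ v → IsTh (proj₁ v)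
    Z⇒IsTh = proj₂ (proj₂ (proj₂ wfρ₀))

    X⇒∈V : ∀ v → X c v → v ∈V s c
    X⇒∈V = proj₁ (proj₂ (proj₂ wf))

    X⇒IsTh : ∀ v → X c v → IsTh (proj₁ v)
    X⇒IsTh = proj₁ (proj₂ (proj₂ (proj₂ wf)))

    θ : Subst
    θ = ⌜ ν ⌝ ↾ vars (s c)

    θ-X : ∀ {σ′} (x : Var σ′) → X c (σ′ , x) → θ x ≡ ⌜ ν ⌝ x
    θ-X x x∈X = ↾-∈ ⌜ ν ⌝ (vars (s c)) x (∈V⇒∈vars (X⇒∈V _ x∈X))

    θ-Valued : Valued (X c) θ
    θ-Valued x x∈X rewrite θ-X x x∈X = ⌜⌝-IsValue ν x (X⇒IsTh _ x∈X)

    θ⊨φ : θ ⊨ con c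
    θ⊨φ = ⊨E⇒⊨ (con c) θ ν ν⊨φ λ x free →
      let x∈X = proj₁ (proj₂ wf) _ free in X⇒IsTh _ x∈X , θ-X x x∈X

    -- A variable of s evaluates to the same value under ν₂ as its image under θ,
    -- because ν₂ only departs from ν on the rule's existential variables.
    θ-X-Eval : ∀ {σ′} (y : Var σ′) → X c (σ′ , y) → ∀ {b} → Eval ν₂ (var y) b →
               ∀ (μ : Valuation) → Eval μ (θ y) b
    θ-X-Eval y y∈X (var y th) μ rewrite θ-X y y∈X | ν₂≈ν y th (s-vars∉zs _ (X⇒∈V _ y∈X)) =
      Eval-⌜⌝ (var y th) μ

    ξ : Subst
    ξ x = γ (ren x) ⟨ θ ⟩

    γ-Z-case : ∀ {σ′} (x : Var σ′) → (σ′ , x) ∈V ℓ₀ → Z ρ₀ (σ′ , x) →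
               IsValue (γ (ren x)) ⊎ Σ (Var σ′) (λ y → γ (ren x) ≡ var y × X c (σ′ , y))
    γ-Z-case x x∈ℓ₀ z = γ-Z (ren x) (∈V-rename ren ℓ₀ x∈ℓ₀) (x , refl , z)

    ξ-IsValue : ∀ {σ′} (x : Var σ′) → (σ′ , x) ∈V ℓ₀ → Z ρ₀ (σ′ , x) → IsValue (ξ x)
    ξ-IsValue x x∈ℓ₀ z with γ-Z-case x x∈ℓ₀ z
    ... | inj₁ v rewrite IsValue-⟨⟩ θ v = v
    ... | inj₂ (y , eq , y∈X) rewrite eq = θ-Valued y y∈X

    ξ-Eval : ∀ {σ′} (x : Var σ′) → (σ′ , x) ∈V ℓ₀ → Z ρ₀ (σ′ , x) →
             ∀ {b} → Eval ν₂ (γ (ren x)) b → ∀ (μ : Valuation) → Eval μ (ξ x) b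
    ξ-Eval x x∈ℓ₀ z ev μ with γ-Z-case x x∈ℓ₀ z
    ... | inj₁ v rewrite IsValue-⟨⟩ θ v = Eval-IsValue v ev
    ... | inj₂ (y , eq , y∈X) rewrite eq = θ-X-Eval y y∈X ev μ

    γ-outside : ∀ {σ′} (x : Var σ′) → ¬ (σ′ , x) ∈V ℓ₀ → γ (ren x) ≡ var (ren x)
    γ-outside x x∉ℓ₀ with γ (ren x) ≟var ren x
    ... | yes eq   = eq
    ... | no moved with ∈V-rename⁻ ren ℓ₀ (to (γ-dom (ren x)) moved)
    ...   | x′ , eq , x′∈ℓ₀ with ren-injective x′ x eq
    ...     | refl = ⊥-elim (x∉ℓ₀ x′∈ℓ₀)

    -- ⟦ρ₀⟧ forces the Z-variables of ℓ₀ to values and every other variable of ℓ₀ to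
    -- itself; the outer substitution θ-outer below supplies the rest of ℓγθ.
    data RuleInstance {σ′} (x : Var σ′) : Term σ′ → Set where
      matched   : (σ′ , x) ∈V ℓ₀ → Z ρ₀ (σ′ , x) → RuleInstance x (ξ x)
      unmatched : (σ′ , x) ∈V ℓ₀ → ¬ Z ρ₀ (σ′ , x) → RuleInstance x (var x)
      extra     : ¬ (σ′ , x) ∈V ℓ₀ → (σ′ , x) ∈V r₀ → RuleInstance x (⌜ ν₂ ⌝ (ren x))
      unused    : ¬ (σ′ , x) ∈V ℓ₀ → ¬ (σ′ , x) ∈V r₀ → RuleInstance x (var x)

    θρ-by-cases : ∀ {σ′} (x : Var σ′) → Dec ((σ′ , x) ∈V ℓ₀) → Dec ((σ′ , x) ∈V r₀) →
                  Σ (Term σ′) (RuleInstance x)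
    θρ-by-cases {σ′} x (yes x∈ℓ₀) _ with decZ (σ′ , x) x∈ℓ₀
    ... | yes z = ξ x , matched x∈ℓ₀ z
    ... | no ¬z = var x , unmatched x∈ℓ₀ ¬z
    θρ-by-cases x (no x∉ℓ₀) (yes x∈r₀) = ⌜ ν₂ ⌝ (ren x) , extra x∉ℓ₀ x∈r₀
    θρ-by-cases x (no x∉ℓ₀) (no x∉r₀)  = var x , unused x∉ℓ₀ x∉r₀

    θρ : Subst
    θρ {σ′} x = proj₁ (θρ-by-cases x ((σ′ , x) ∈V? ℓ₀) ((σ′ , x) ∈V? r₀))

    θρ-view : ∀ {σ′} (x : Var σ′) → RuleInstance x (θρ x)
    θρ-view {σ′} x = proj₂ (θρ-by-cases x ((σ′ , x) ∈V? ℓ₀) ((σ′ , x) ∈V? r₀))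

    Occurs : SVar → Set
    Occurs v = v ∈V ℓ₀ ⊎ v ∈V r₀

    instance-IsValue : ∀ {σ′} {x : Var σ′} {t} → RuleInstance x t →
                       Z ρ₀ (σ′ , x) → Occurs (σ′ , x) → IsValue t
    instance-IsValue (matched x∈ℓ₀ _)       z _ = ξ-IsValue _ x∈ℓ₀ z
    instance-IsValue (unmatched _ ¬z)       z _ = ⊥-elim (¬z z)
    instance-IsValue (extra _ _)            z _ = ⌜⌝-IsValue ν₂ _ (Z⇒IsTh _ z)
    instance-IsValue (unused x∉ℓ₀ x∉r₀)     _ o = ⊥-elim ([ x∉ℓ₀ , x∉r₀ ] o)

    instance-moved : ∀ {σ′} {x : Var σ′} {t} → RuleInstance x t → t ≢ var x →
                     Z ρ₀ (σ′ , x) × Occurs (σ′ , x)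
    instance-moved (matched x∈ℓ₀ z)      _     = z , inj₁ x∈ℓ₀
    instance-moved (unmatched _ _)       moved = ⊥-elim (moved refl)
    instance-moved (extra x∉ℓ₀ x∈r₀)     _     = ExVar⊆Z _ (x∈r₀ , x∉ℓ₀) , inj₂ x∈r₀
    instance-moved (unused _ _)          moved = ⊥-elim (moved refl)

    θρ-dom : ∀ {σ′} (x : Var σ′) → (θρ x ≢ var x) ⇔ (Z ρ₀ (σ′ , x) × Occurs (σ′ , x))
    θρ-dom x = mk⇔ (instance-moved (θρ-view x))
                   λ (z , o) → IsValue⇒≢var (instance-IsValue (θρ-view x) z o)

    θρ-values : ∀ {σ′} (x : Var σ′) → IsValue (θρ x) ⇔ (Z ρ₀ (σ′ , x) × Occurs (σ′ , x))
    θρ-values x = mk⇔ (λ v → to (θρ-dom x) (IsValue⇒≢var v))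
                      λ (z , o) → instance-IsValue (θρ-view x) z o

    θρ-FinDom : FinDom θρ
    θρ-FinDom = vars ℓ₀ ++ vars r₀ , λ x moved →
      [ (λ x∈ℓ₀ → ∈-++⁺ˡ (∈V⇒∈vars x∈ℓ₀)) , (λ x∈r₀ → ∈-++⁺ʳ (vars ℓ₀) (∈V⇒∈vars x∈r₀)) ]
        (proj₂ (to (θρ-dom x) moved))

    Occurs? : ∀ v → Dec (Occurs v)
    Occurs? v = (v ∈V? ℓ₀) ⊎-dec (v ∈V? r₀)

    ¬Occurs? : ∀ v → Dec (¬ Occurs v)
    ¬Occurs? v = ¬? (Occurs? v)

    zs₀ : List SVar
    zs₀ = filter ¬Occurs? (vars π₀)

    zs₀-spec : ∀ v → v ∈ zs₀ ⇔ (v ∈V π₀ × ¬ Occurs v)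
    zs₀-spec v =
      mk⇔ (λ m → let (v∈π₀ , ¬o) = ∈-filter⁻ ¬Occurs? {xs = vars π₀} m in ∈vars⇒∈V π₀ v∈π₀ , ¬o)
          λ (v∈π₀ , ¬o) → ∈-filter⁺ ¬Occurs? (∈V⇒∈vars v∈π₀) ¬o

    free-Occurs : ∀ v → FVarE (E[ zs₀ ] π₀) v → Occurs v
    free-Occurs v (v∈π₀ , v∉zs₀) with Occurs? v
    ... | yes o = o
    ... | no ¬o = ⊥-elim (v∉zs₀ (from (zs₀-spec v) (v∈π₀ , ¬o)))

    free-Eval : ∀ {σ′} (x : Var σ′) → FVarE (E[ zs₀ ] π₀) (σ′ , x) → ∀ {t} → RuleInstance x t →
                ∀ {b} → Eval ν₂ (γ (ren x)) b → ∀ (μ : Valuation) → Eval μ t b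
    free-Eval x free (matched x∈ℓ₀ z) ev μ = ξ-Eval x x∈ℓ₀ z ev μ
    free-Eval x free (unmatched _ ¬z) ev μ = ⊥-elim (¬z (π₀⊆Z _ (proj₁ free)))
    free-Eval x free (extra x∉ℓ₀ _) ev μ rewrite γ-outside x x∉ℓ₀ = Eval-⌜⌝ ev μ
    free-Eval x free (unused x∉ℓ₀ x∉r₀) ev μ = ⊥-elim ([ x∉ℓ₀ , x∉r₀ ] (free-Occurs _ free))

    θρ⊨π₀ : θρ ⊨ (E[ zs₀ ] π₀)
    θρ⊨π₀ = (λ x free → instance-IsValue (θρ-view x) (π₀⊆Z _ (proj₁ free)) (free-Occurs _ free))
          , Valid-⟨⟩E (E[ zs₀ ] π₀) θρ (λ x → γ (ren x)) ν₂ (λ x → ν₂ (ren x)) π₀γ-true bound-Eval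
              (λ x free → free-Eval x free (θρ-view x))
      where
      π₀γ-true : Eval ν₂ (π₀ ⟨ (λ x → γ (ren x)) ⟩) true
      π₀γ-true rewrite sym (⟨⟩-∘ π₀ (λ x → var (ren x)) γ) = πγ-true

      bound-Eval : ∀ {σ′} (x : Var σ′) → (σ′ , x) ∈ zs₀ → ∀ {b} → Eval ν₂ (γ (ren x)) b →
                   Eval (λ y → ν₂ (ren y)) (var x) b
      bound-Eval x x∈zs₀ ev rewrite γ-outside x (λ x∈ℓ₀ → proj₂ (to (zs₀-spec _) x∈zs₀) (inj₁ x∈ℓ₀))
        with ev
      ... | var _ th = var x th

    ρ₀-instance : InRule ρ₀ (ℓ₀ ⟨ θρ ⟩) (r₀ ⟨ θρ ⟩)
    ρ₀-instance = inst θρ θρ-FinDom θρ-dom θρ-values zs₀ zs₀-spec θρ⊨π₀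

    θ-outer : Subst
    θ-outer = ξ ↾ vars ℓ₀

    instance-outer : ∀ {σ′} (x : Var σ′) → (σ′ , x) ∈V ℓ₀ → ∀ {t} → RuleInstance x t →
                     t ⟨ θ-outer ⟩ ≡ ξ x
    instance-outer x _ (matched x∈ℓ₀ z)   = IsValue-⟨⟩ θ-outer (ξ-IsValue x x∈ℓ₀ z)
    instance-outer x x∈ℓ₀ (unmatched _ _) = ↾-∈ ξ (vars ℓ₀) x (∈V⇒∈vars x∈ℓ₀)
    instance-outer x x∈ℓ₀ (extra x∉ℓ₀ _)  = ⊥-elim (x∉ℓ₀ x∈ℓ₀)
    instance-outer x x∈ℓ₀ (unused x∉ℓ₀ _) = ⊥-elim (x∉ℓ₀ x∈ℓ₀)

    ℓ₀θρ-outer≡ℓγθ : ℓ₀ ⟨ θρ ⟩ ⟨ θ-outer ⟩ ≡ lhs (renameRule ren ρ₀) ⟨ γ ⟩ ⟨ θ ⟩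
    ℓ₀θρ-outer≡ℓγθ = begin
      ℓ₀ ⟨ θρ ⟩ ⟨ θ-outer ⟩                   ≡⟨ ⟨⟩-∘ ℓ₀ θρ θ-outer ⟩
      ℓ₀ ⟨ (λ x → θρ x ⟨ θ-outer ⟩) ⟩         ≡⟨ ⟨⟩-cong ℓ₀ (λ x x∈ℓ₀ → instance-outer x x∈ℓ₀ (θρ-view x)) ⟩
      ℓ₀ ⟨ ξ ⟩                                ≡⟨ ⟨⟩-∘ ℓ₀ (λ x → γ (ren x)) θ ⟨
      ℓ₀ ⟨ (λ x → γ (ren x)) ⟩ ⟨ θ ⟩          ≡⟨ cong (_⟨ θ ⟩) (⟨⟩-∘ ℓ₀ (λ x → var (ren x)) γ) ⟨
      ℓ₀ ⟨ (λ x → var (ren x)) ⟩ ⟨ γ ⟩ ⟨ θ ⟩  ∎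
      where open ≡-Reasoning

    instance-reducible : Σ (Term τ) (RStep R (s c ⟨ θ ⟩))
    instance-reducible =
      let s|p = subst (Sub (s c ⟨ θ ⟩) p) (sym ℓ₀θρ-outer≡ℓγθ) (Sub-⟨⟩ θ s|p≡ℓγ)
          (t , repl) = Sub⇒Repl s|p (r₀ ⟨ θρ ⟩ ⟨ θ-outer ⟩)
      in t , rstep ρ₀ Rρ₀ _ _ ρ₀-instance p θ-outer (↾-FinDom ξ (vars ℓ₀)) s|p repl

    ¬InstNormal : ¬ InstNormal R c
    ¬InstNormal instN =
      let (t , s⟨θ⟩→t) = instance-reducible
      in instN θ (↾-FinDom ⌜ ν ⌝ (vars (s c))) θ-Valued θ⊨φ t s⟨θ⟩→t

  mostGeneral⇒partial : ∀ {R : RuleSet} {τ} {c c′ : CTerm τ} →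
                        Step mostGeneral R c c′ → Step partial R c c′
  mostGeneral⇒partial (step ρ₀ ρ Rρ₀ v (ν , ν⊨φ) disj p γ zs zs-spec γ-dom s|p γ-Z implies t repl ys ys-spec) =
    step ρ₀ ρ Rρ₀ v (ν , ν⊨φ) disj p γ zs zs-spec γ-dom s|p γ-Z (ν , ν⊨φ , implies ν ν⊨φ) t repl ys ys-spec

  InstNormal⇒partial-NF : (R : RuleSet) → IsLCTRS R → ∀ {τ} (c : CTerm τ) → WfCTerm c →
                          InstNormal R c → NormalForm partial R c
  InstNormal⇒partial-NF R isL c wf instN _
    (step ρ₀ _ Rρ₀ (variant ren ren-bijective) _ disj p γ zs zs-spec γ-dom s|p γ-Z
          (ν , ν⊨φ , ν₂ , ν₂≈ν , πγ-true) _ _ _ _) =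
    -- Z ρ₀ need not be decidable, but the goal is ⊥, so it may be decided on the
    -- finitely many variables of the left-hand side.
    ¬¬-decidable-on (vars (lhs ρ₀)) (Z ρ₀) λ decZ →
      PartialRedexInstance.¬InstNormal R c wf ρ₀ Rρ₀ (proj₁ (proj₁ isL ρ₀ Rρ₀))
        (λ v v∈ℓ₀ → decZ v (∈V⇒∈vars v∈ℓ₀)) ren (proj₁ ren-bijective)
        p γ zs s-vars∉zs γ-dom s|p γ-Z ν ν⊨φ ν₂ ν₂≈ν πγ-true instN
    where
    s-vars∉zs : ∀ v → v ∈V s c → v ∉ zs
    s-vars∉zs v v∈s v∈zs = disj v (inj₂ (inj₂ (proj₁ (to (zs-spec v) v∈zs)))) (inj₁ v∈s)

proposition6p9 : {𝒮 : Setting} (𝓜 : Model 𝒮) →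
    let open LCTRS 𝓜 in
    (R : RuleSet) → IsLCTRS R →
    {τ : Sort (Setting.S 𝒮)} (c : CTerm τ) → WfCTerm c →
    InstNormal R c →
    NormalForm partial R c × NormalForm mostGeneral R c
proposition6p9 𝓜 R isL c wf instN =
  partial-NF , λ c′ st → partial-NF c′ (mostGeneral⇒partial 𝓜 st)
  where
  open LCTRS 𝓜
  partial-NF : NormalForm partial R c
  partial-NF = InstNormal⇒partial-NF 𝓜 R isL c wf instN
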